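{- A simple permutation avoids both $1342$ and $1423$ if and only if it avoids $123$. That is, the simple permutations in the class $\mathrm{Av}(1342,1423)$ are exactly the simple permutations in $\mathrm{Av}(123)$.
   Context: $\mathrm{Av}(B)$ denotes the set of permutations containing no pattern from $B$, where $\sigma$ is contained in $\pi$ if some subsequence of $\pi$ has the same relative order as $\sigma$. An interval of a permutation $\pi_1\cdots\pi_n$ is a set of positionally contiguous entries $\pi_i\pi_{i+1}\cdots\pi_{i+m}$ whose values form a set of consecutive integers. A permutation of length $n$ is simple if its only intervals have size $1$ or $n$. -}

module Defs where

open import Data.Nat using (ℕ; zero; suc; _∸_; _≤_)
open import Data.Fin using (Fin; toℕ) renaming (_<_ to _<ᶠ_; _≤_ to _≤ᶠ_)
open import Data.Fin.Patterns using (0F; 1F; 2F; 3F)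
open import Data.Fin.Permutation using (Permutation′; _⟨$⟩ʳ_)
open import Data.Vec using (Vec; lookup; []; _∷_)
open import Data.Product using (Σ; _×_)
open import Data.Sum using (_⊎_)
open import Relation.Nullary using (¬_)
open import Relation.Binary.PropositionalEquality using (_≡_)
open import Function.Bundles using (_⇔_)

-- A permutation of length n (positions and values both Fin n, 0-indexed;
-- one-line notation π(0) π(1) ... π(n-1)).
Perm : ℕ → Set
Perm n = Permutation′ n

_at_ : ∀ {n} → Perm n → Fin n → Fin n
π at i = π ⟨$⟩ʳ i

-- A pattern of length k in one-line notation (0-indexed values), e.g.
-- 123 is written 0 ∷ 1 ∷ 2 ∷ [].
Pattern : ℕ → Set
Pattern k = Vec (Fin k) k

p123 : Pattern 3
p123 = 0F ∷ 1F ∷ 2F ∷ []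

p1342 : Pattern 4
p1342 = 0F ∷ 2F ∷ 3F ∷ 1F ∷ []

p1423 : Pattern 4
p1423 = 0F ∷ 3F ∷ 1F ∷ 2F ∷ []

Contains : ∀ {n k} → Perm n → Pattern k → Set
Contains {n} {k} π σ =
  Σ (Fin k → Fin n) λ e →
    (∀ i j → i <ᶠ j → e i <ᶠ e j) ×
    (∀ i j → (lookup σ i <ᶠ lookup σ j) ⇔ (π at e i <ᶠ π at e j))

Avoids : ∀ {n k} → Perm n → Pattern k → Set
Avoids π σ = ¬ Contains π σ

IsInterval : ∀ {n} → Perm n → Fin n → Fin n → Set
IsInterval {n} π i j =
  i ≤ᶠ j ×
  Σ ℕ λ a → Σ ℕ λ b → a ≤ b ×
    (∀ p → i ≤ᶠ p → p ≤ᶠ j → a ≤ toℕ (π at p) × toℕ (π at p) ≤ b) ×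
    (∀ v → a ≤ v → v ≤ b → Σ (Fin n) λ p → i ≤ᶠ p × p ≤ᶠ j × toℕ (π at p) ≡ v)

blockSize : ∀ {n} → Fin n → Fin n → ℕ
blockSize i j = suc (toℕ j ∸ toℕ i)

Simple : ∀ {n} → Perm n → Set
Simple {n} π = ∀ i j → IsInterval π i j → (blockSize i j ≡ 1) ⊎ (blockSize i j ≡ n)

-- Avoiding 123 trivially implies avoiding 1342 and 1423, which contain it.
-- Conversely, let π be simple, avoid 1342 and 1423, and contain 123. Among
-- the entries starting a 123 take one, a, of largest value; let y be the
-- first entry right of a lying above a, and w the first entry right of a
-- lying above y. Let lo be the least bound exceeding every value below a
-- that occurs right of w. The two avoidances and the maximality of a force
-- the entries with values in [lo, π(y)] to fill a block of consecutive
-- positions, lying left of w and containing both a and y: a proper interval.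
module Submission where

open import Defs
open import Data.Nat
  using (ℕ; zero; suc; _+_; z<s; s<s; s≤s⁻¹; s<s⁻¹; _<_; _≤_; _≤?_; _<?_; _≟_)
open import Data.Nat.Properties
open import Data.Fin using (Fin; zero; suc; toℕ; fromℕ<; inject₁) renaming (_<_ to _<ᶠ_; _≤_ to _≤ᶠ_)
open import Data.Fin.Patterns using (0F; 1F; 2F; 3F)
import Data.Fin.Properties as Finₚ
open import Data.Fin.Properties using (any?; all?; toℕ-injective; toℕ-fromℕ<; toℕ<n)
open import Data.Fin.Permutation using (_⟨$⟩ˡ_; inverseˡ; inverseʳ)
open import Data.Vec using (lookup; []; _∷_)
open import Data.Product using (Σ; ∃; ∃₂; _×_; _,_; proj₁; proj₂)
open import Data.Sum using (inj₁; inj₂)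
open import Data.Empty using (⊥; ⊥-elim)
open import Function using (id; _∘_)
open import Function.Bundles using (_⇔_; mk⇔; Equivalence)
open import Relation.Nullary using (¬_; yes; no; contradiction)
open import Relation.Nullary.Decidable using (_×-dec_; _→-dec_)
open import Relation.Unary using (Decidable)
open import Relation.Binary using (tri<; tri≈; tri>)
open import Relation.Binary.PropositionalEquality using (_≡_; refl; sym; trans; cong; subst; subst₂; module ≡-Reasoning)

module _ {P : ℕ → Set} (P? : Decidable P) where

  private
    search : ∀ i → (∀ {j} → j < i → ¬ P j) → ∀ d → P (i + d) →
             Σ ℕ λ m → P m × (∀ {j} → P j → m ≤ j)
    search i below d Pi+d with P? i
    ... | yes Pi = i , Pi , λ Pj → ≮⇒≥ (λ j<i → below j<i Pj)
    search i below zero    Pi+0 | no ¬Pi = contradiction (subst P (+-identityʳ i) Pi+0) ¬Pi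
    search i below (suc d) Pi+d | no ¬Pi = search (suc i) below′ d (subst P (+-suc i d) Pi+d)
      where
      below′ : ∀ {j} → j < suc i → ¬ P j
      below′ j<1+i with m≤n⇒m<n∨m≡n (s≤s⁻¹ j<1+i)
      ... | inj₁ j<i  = below j<i
      ... | inj₂ refl = ¬Pi

  least : ∀ {k} → P k → Σ ℕ λ m → P m × (∀ {j} → P j → m ≤ j)
  least {k} = search 0 (λ ()) k

  greatest : ∀ B → (∀ {j} → P j → j ≤ B) →
             ∀ {k} → P k → Σ ℕ λ m → P m × (∀ {j} → P j → j ≤ m)
  greatest B bounded Pk with P? B
  ... | yes PB = B , PB , bounded
  greatest zero    bounded Pk | no ¬PB = contradiction (subst P (n≤0⇒n≡0 (bounded Pk)) Pk) ¬PB
  greatest (suc B) bounded Pk | no ¬PB = greatest B bounded′ Pk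
    where
    bounded′ : ∀ {j} → P j → j ≤ B
    bounded′ Pj = s≤s⁻¹ (≤∧≢⇒< (bounded Pj) λ { refl → ¬PB Pj })

module _ {n m} {Q : Fin n → Set} (Q? : Decidable Q) (f : Fin n → Fin m) where

  private
    Attained : ℕ → Set
    Attained k = ∃ λ p → Q p × toℕ (f p) ≡ k

    attained? : Decidable Attained
    attained? k = any? λ p → Q? p ×-dec (toℕ (f p) ≟ k)

  argmin : ∀ {q} → Q q → Σ (Fin n) λ p → Q p × (∀ {q} → Q q → f p ≤ᶠ f q)
  argmin Qq with least attained? (_ , Qq , refl)
  ... | _ , (p , Qp , refl) , minimal = p , Qp , λ Qq′ → minimal (_ , Qq′ , refl)

  argmax : ∀ {q} → Q q → Σ (Fin n) λ p → Q p × (∀ {q} → Q q → f q ≤ᶠ f p)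
  argmax Qq with greatest attained? m (λ { (p , _ , refl) → <⇒≤ (toℕ<n (f p)) }) (_ , Qq , refl)
  ... | _ , (p , Qp , refl) , maximal = p , Qp , λ Qq′ → maximal (_ , Qq′ , refl)

increasing-chain : ∀ {k} (f : Fin (suc k) → ℕ) → (∀ i → f (inject₁ i) < f (suc i)) →
                   ∀ {i j} → i <ᶠ j → f i < f j
increasing-chain {suc k} f step {zero} {suc zero} _ = step zero
increasing-chain {suc k} f step {zero} {suc (suc j)} _ =
  <-trans (step zero) (increasing-chain (f ∘ suc) (step ∘ suc) {zero} {suc j} z<s)
increasing-chain {suc k} f step {suc i} {suc j} i<j =
  increasing-chain (f ∘ suc) (step ∘ suc) (s<s⁻¹ i<j)

module _ {n} (π : Perm n) where

  val : Fin n → ℕ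
  val p = toℕ (π at p)

  val-injective : ∀ {p q} → val p ≡ val q → p ≡ q
  val-injective {p} {q} vp≡vq = begin
    p                      ≡⟨ sym (inverseˡ π) ⟩
    π ⟨$⟩ˡ (π at p)        ≡⟨ cong (π ⟨$⟩ˡ_) (toℕ-injective vp≡vq) ⟩
    π ⟨$⟩ˡ (π at q)        ≡⟨ inverseˡ π ⟩
    q                      ∎
    where open ≡-Reasoning

  -- An occurrence of σ is an increasing choice of positions whose values increase
  -- when read in the order τ = σ⁻¹; it suffices to check consecutive pairs.
  contains-by-chains : ∀ {k} (σ τ : Pattern (suc k)) → (∀ i → lookup τ (lookup σ i) ≡ i) →
    (e : Fin (suc k) → Fin n) →
    (∀ i → e (inject₁ i) <ᶠ e (suc i)) →
    (∀ u → val (e (lookup τ (inject₁ u))) < val (e (lookup τ (suc u)))) →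
    Contains π σ
  contains-by-chains σ τ τ∘σ≡id e positions values =
    e , (λ _ _ → increasing-chain (toℕ ∘ e) positions) , λ i j → mk⇔ (to i j) (from i j)
    where
    to : ∀ i j → lookup σ i <ᶠ lookup σ j → val (e i) < val (e j)
    to i j σi<σj = subst₂ (λ i j → val (e i) < val (e j)) (τ∘σ≡id i) (τ∘σ≡id j)
                          (increasing-chain (val ∘ e ∘ lookup τ) values σi<σj)

    from : ∀ i j → val (e i) < val (e j) → lookup σ i <ᶠ lookup σ j
    from i j vei<vej with Finₚ.<-cmp (lookup σ i) (lookup σ j)
    ... | tri< σi<σj _ _ = σi<σj
    ... | tri≈ _ σi≡σj _ = contradiction vei<vej (<-irrefl (cong (val ∘ e) i≡j))
      where
      i≡j = trans (sym (τ∘σ≡id i)) (trans (cong (lookup τ) σi≡σj) (τ∘σ≡id j))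
    ... | tri> _ _ σj<σi = contradiction (to j i σj<σi) (<-asym vei<vej)

  contains-123 : ∀ {p q r} → p <ᶠ q → q <ᶠ r →
    val p < val q → val q < val r → Contains π p123
  contains-123 {p} {q} {r} p<q q<r vp<vq vq<vr =
    contains-by-chains p123 p123 (λ { 0F → refl ; 1F → refl ; 2F → refl })
      (lookup (p ∷ q ∷ r ∷ []))
      (λ { 0F → p<q ; 1F → q<r })
      (λ { 0F → vp<vq ; 1F → vq<vr })

  contains-1342 : ∀ {p q r s} → p <ᶠ q → q <ᶠ r → r <ᶠ s →
    val p < val s → val s < val q → val q < val r → Contains π p1342
  contains-1342 {p} {q} {r} {s} p<q q<r r<s vp<vs vs<vq vq<vr =
    contains-by-chains p1342 p1423 (λ { 0F → refl ; 1F → refl ; 2F → refl ; 3F → refl })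
      (lookup (p ∷ q ∷ r ∷ s ∷ []))
      (λ { 0F → p<q ; 1F → q<r ; 2F → r<s })
      (λ { 0F → vp<vs ; 1F → vs<vq ; 2F → vq<vr })

  contains-1423 : ∀ {p q r s} → p <ᶠ q → q <ᶠ r → r <ᶠ s →
    val p < val r → val r < val s → val s < val q → Contains π p1423
  contains-1423 {p} {q} {r} {s} p<q q<r r<s vp<vr vr<vs vs<vq =
    contains-by-chains p1423 p1342 (λ { 0F → refl ; 1F → refl ; 2F → refl ; 3F → refl })
      (lookup (p ∷ q ∷ r ∷ s ∷ []))
      (λ { 0F → p<q ; 1F → q<r ; 2F → r<s })
      (λ { 0F → vp<vr ; 1F → vr<vs ; 2F → vs<vq })

  p1342⇒p123 : Contains π p1342 → Contains π p123
  p1342⇒p123 (e , increasing , order) =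
    contains-123 (increasing 0F 1F z<s) (increasing 1F 2F (s<s z<s))
                 (Equivalence.to (order 0F 1F) z<s) (Equivalence.to (order 1F 2F) (s<s (s<s z<s)))

  p1423⇒p123 : Contains π p1423 → Contains π p123
  p1423⇒p123 (e , increasing , order) =
    contains-123 (increasing 0F 2F z<s) (increasing 2F 3F (s<s (s<s z<s)))
                 (Equivalence.to (order 0F 2F) z<s) (Equivalence.to (order 2F 3F) (s<s z<s))

  ValueIn : ℕ → ℕ → Fin n → Set
  ValueIn lo hi p = lo ≤ val p × val p ≤ hi

  valueIn? : ∀ lo hi → Decidable (ValueIn lo hi)
  valueIn? lo hi p = (lo ≤? val p) ×-dec (val p ≤? hi)

  isInterval-of-band : ∀ {i j lo hi} → i ≤ᶠ j → lo ≤ hi → hi < n →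
    (∀ {p} → i ≤ᶠ p → p ≤ᶠ j → ValueIn lo hi p) →
    (∀ {p} → ValueIn lo hi p → i ≤ᶠ p × p ≤ᶠ j) →
    IsInterval π i j
  isInterval-of-band {i} {j} {lo} {hi} i≤j lo≤hi hi<n inside occupied =
    i≤j , lo , hi , lo≤hi , (λ _ → inside) , attained
    where
    attained : ∀ v → lo ≤ v → v ≤ hi → Σ (Fin n) λ p → i ≤ᶠ p × p ≤ᶠ j × val p ≡ v
    attained v lo≤v v≤hi =
      let i≤p , p≤j = occupied (subst (lo ≤_) (sym vp≡v) lo≤v , subst (_≤ hi) (sym vp≡v) v≤hi)
      in p , i≤p , p≤j , vp≡v
      where
      v<n = ≤-<-trans v≤hi hi<n
      p = π ⟨$⟩ˡ fromℕ< v<n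
      vp≡v : val p ≡ v
      vp≡v = trans (cong toℕ (inverseʳ π)) (toℕ-fromℕ< v<n)

  proper-interval⇒¬simple : ∀ {i j k} → IsInterval π i j → i <ᶠ j → j <ᶠ k → ¬ Simple π
  proper-interval⇒¬simple {i} {j} {k} interval i<j j<k simple with simple i j interval
  ... | inj₁ size≡1 = <⇒≱ i<j (m∸n≡0⇒m≤n (suc-injective size≡1))
  ... | inj₂ size≡n =
    <⇒≱ j<k (≤-trans (s≤s⁻¹ (subst (toℕ k <_) (sym size≡n) (toℕ<n k))) (m∸n≤m (toℕ j) (toℕ i)))

  module SimpleAvoider (simple : Simple π)
                       (avoids-1342 : Avoids π p1342) (avoids-1423 : Avoids π p1423) where

    Starts123 : Fin n → Set
    Starts123 p = ∃₂ λ q r → p <ᶠ q × q <ᶠ r × val p < val q × val q < val r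

    starts123? : Decidable Starts123
    starts123? p = any? λ q → any? λ r →
      (toℕ p <? toℕ q) ×-dec (toℕ q <? toℕ r) ×-dec (val p <? val q) ×-dec (val q <? val r)

    RightAbove : Fin n → ℕ → Fin n → Set
    RightAbove a t p = a <ᶠ p × t < val p

    rightAbove? : ∀ a t → Decidable (RightAbove a t)
    rightAbove? a t p = (toℕ a <? toℕ p) ×-dec (t <? val p)

    module Peak (a : Fin n) (a-starts : Starts123 a)
                (a-highest : ∀ {p} → Starts123 p → val p ≤ val a) where

      module Rise (y : Fin n) (a<y : a <ᶠ y) (va<vy : val a < val y)
                  (y-leftmost : ∀ {p} → RightAbove a (val a) p → y ≤ᶠ p) where

        right-above-y : ∀ {q r} → a <ᶠ q → q <ᶠ r → val a < val q → val q < val r →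
                        ∃ (RightAbove a (val y))
        right-above-y {q} {r} a<q q<r va<vq vq<vr with y-leftmost (a<q , va<vq) | <-cmp (val y) (val r)
        ... | y≤q | tri< vy<vr _ _ = r , <-trans a<q q<r , vy<vr
        ... | y≤q | tri≈ _ vy≡vr _ = ⊥-elim (<⇒≱ q<r (subst (_≤ᶠ q) (val-injective vy≡vr) y≤q))
        ... | y≤q | tri> _ _ vr<vy = ⊥-elim (avoids-1423 (contains-1423 a<y y<q q<r va<vq vq<vr vr<vy))
          where
          y<q : y <ᶠ q
          y<q = Finₚ.≤∧≢⇒< y≤q λ { refl → <-asym vq<vr vr<vy }

        module Leap (w : Fin n) (a<w : a <ᶠ w) (vy<vw : val y < val w)
                    (w-leftmost : ∀ {p} → RightAbove a (val y) p → w ≤ᶠ p) where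

          y<w : y <ᶠ w
          y<w = Finₚ.≤∧≢⇒< (y-leftmost (a<w , <-trans va<vy vy<vw))
                           (λ y≡w → <-irrefl (cong val y≡w) vy<vw)

          BoundsLowTail : ℕ → Set
          BoundsLowTail k = ∀ e → w <ᶠ e → val e < val a → val e < k

          boundsLowTail? : Decidable BoundsLowTail
          boundsLowTail? k = all? λ e → (toℕ w <? toℕ e) →-dec (val e <? val a) →-dec (val e <? k)

          lowTail-witness : ∀ {k} → ¬ BoundsLowTail k → ∃ λ e → w <ᶠ e × val e < val a × k ≤ val e
          lowTail-witness {k} unbounded
            with any? (λ e → (toℕ w <? toℕ e) ×-dec (val e <? val a) ×-dec (k ≤? val e))
          ... | yes witness = witness
          ... | no ¬witness = ⊥-elim (unbounded λ e w<e ve<va →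
                                ≰⇒> λ k≤ve → ¬witness (e , w<e , ve<va , k≤ve))

          module Floor (lo : ℕ) (lo-bounds : BoundsLowTail lo)
                       (lo-least : ∀ {k} → BoundsLowTail k → lo ≤ k) where

            InBand : Fin n → Set
            InBand = ValueIn lo (val y)

            lo≤va : lo ≤ val a
            lo≤va = lo-least λ _ _ ve<va → ve<va

            a-in-band : InBand a
            a-in-band = lo≤va , <⇒≤ va<vy

            y-in-band : InBand y
            y-in-band = ≤-trans lo≤va (<⇒≤ va<vy) , ≤-refl

            in-band⇒left-of-w : ∀ {p} → InBand p → p <ᶠ w
            in-band⇒left-of-w {p} (lo≤vp , vp≤vy) with Finₚ.<-cmp p w
            ... | tri< p<w _ _ = p<w
            ... | tri≈ _ refl _ = ⊥-elim (<⇒≱ vy<vw vp≤vy)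
            ... | tri> _ _ w<p with <-cmp (val p) (val a)
            ...   | tri< vp<va _ _ = ⊥-elim (<⇒≱ (lo-bounds p w<p vp<va) lo≤vp)
            ...   | tri≈ _ vp≡va _ = ⊥-elim (<-asym a<w (subst (w <ᶠ_) (val-injective vp≡va) w<p))
            ...   | tri> _ _ va<vp = ⊥-elim (avoids-1342 (contains-1342 a<y y<w w<p va<vp vp<vy vy<vw))
              where
              vp<vy : val p < val y
              vp<vy = ≤∧≢⇒< vp≤vy λ vp≡vy → Finₚ.<⇒≢ (<-trans y<w w<p) (sym (val-injective vp≡vy))

            -- p would start the 123 formed by p, y and w.
            in-band-left-of-y⇒≤va : ∀ {p} → InBand p → p <ᶠ y → val p ≤ val a
            in-band-left-of-y⇒≤va (_ , vp≤vy) p<y = a-highest (_ , _ , p<y , y<w , vp<vy , vy<vw)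
              where
              vp<vy = ≤∧≢⇒< vp≤vy λ vp≡vy → Finₚ.<⇒≢ p<y (val-injective vp≡vy)

            module Band (i : Fin n) (i-in-band : InBand i) (i-leftmost : ∀ {p} → InBand p → i ≤ᶠ p)
                        (j : Fin n) (j-in-band : InBand j) (j-rightmost : ∀ {p} → InBand p → p ≤ᶠ j) where

              j<w : j <ᶠ w
              j<w = in-band⇒left-of-w j-in-band

              between⇒≯vy : ∀ {h} → i ≤ᶠ h → h ≤ᶠ j → ¬ (val y < val h)
              between⇒≯vy {h} i≤h h≤j vy<vh = avoids-1423 (contains-1423 i<h h<a a<y vi<va va<vy vy<vh)
                where
                h<a : h <ᶠ a
                h<a with Finₚ.<-cmp h a
                ... | tri< h<a _ _ = h<a
                ... | tri≈ _ refl _ = ⊥-elim (<-asym va<vy vy<vh)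
                ... | tri> _ _ a<h = ⊥-elim (<⇒≱ (≤-<-trans h≤j j<w) (w-leftmost (a<h , vy<vh)))

                i<h : i <ᶠ h
                i<h = Finₚ.≤∧≢⇒< i≤h λ { refl → <⇒≱ vy<vh (proj₂ i-in-band) }

                vi<va : val i < val a
                vi<va = ≤∧≢⇒< (in-band-left-of-y⇒≤va i-in-band (<-trans (≤-<-trans i≤h h<a) a<y))
                              λ vi≡va → Finₚ.<⇒≢ (≤-<-trans i≤h h<a) (val-injective vi≡va)

              between⇒≮lo : ∀ {h} → i ≤ᶠ h → h ≤ᶠ j → ¬ (val h < lo)
              between⇒≮lo {h} i≤h h≤j vh<lo
                with lowTail-witness (λ bounds → <⇒≱ vh<lo (lo-least bounds))
              ... | e , w<e , ve<va , vh≤ve = avoids-1342 (contains-1342 h<j j<w w<e vh<ve ve<vj vj<vw)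
                where
                h<j : h <ᶠ j
                h<j = Finₚ.≤∧≢⇒< h≤j λ { refl → <⇒≱ vh<lo (proj₁ j-in-band) }

                vh<ve : val h < val e
                vh<ve = ≤∧≢⇒< vh≤ve λ vh≡ve →
                  Finₚ.<⇒≢ (<-trans (≤-<-trans h≤j j<w) w<e) (val-injective vh≡ve)

                ve<vj : val e < val j
                ve<vj = <-≤-trans (lo-bounds e w<e ve<va) (proj₁ j-in-band)

                vj<vw : val j < val w
                vj<vw = ≤-<-trans (proj₂ j-in-band) vy<vw

              band-isInterval : IsInterval π i j
              band-isInterval =
                isInterval-of-band (≤-trans (i-leftmost a-in-band) (j-rightmost a-in-band))
                  (proj₁ y-in-band) (toℕ<n (π at y))
                  (λ i≤p p≤j → ≮⇒≥ (between⇒≮lo i≤p p≤j) , ≮⇒≥ (between⇒≯vy i≤p p≤j))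
                  (λ p-in-band → i-leftmost p-in-band , j-rightmost p-in-band)

              impossible : ⊥
              impossible = proper-interval⇒¬simple band-isInterval i<j j<w simple
                where
                i<j = ≤-<-trans (i-leftmost a-in-band) (<-≤-trans a<y (j-rightmost y-in-band))

            impossible : ⊥
            impossible =
              let i , i-in-band , i-leftmost  = argmin (valueIn? lo (val y)) id a-in-band
                  j , j-in-band , j-rightmost = argmax (valueIn? lo (val y)) id a-in-band
              in Band.impossible i i-in-band i-leftmost j j-in-band j-rightmost

          impossible : ⊥
          impossible =
            let lo , lo-bounds , lo-least = least boundsLowTail? {val a} λ _ _ ve<va → ve<va
            in Floor.impossible lo lo-bounds lo-least

        impossible : ⊥
        impossible =
          let _ , _ , a<q , q<r , va<vq , vq<vr = a-starts
              w , (a<w , vy<vw) , w-leftmost =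
                argmin (rightAbove? a (val y)) id (proj₂ (right-above-y a<q q<r va<vq vq<vr))
          in Leap.impossible w a<w vy<vw w-leftmost

      impossible : ⊥
      impossible =
        let q , _ , a<q , _ , va<vq , _ = a-starts
            y , (a<y , va<vy) , y-leftmost = argmin (rightAbove? a (val a)) id (a<q , va<vq)
        in Rise.impossible y a<y va<vy y-leftmost

    avoids-123 : Avoids π p123
    avoids-123 (e , increasing , order) =
      let a , a-starts , a-highest =
            argmax starts123? (π at_)
              (e 1F , e 2F , increasing 0F 1F z<s , increasing 1F 2F (s<s z<s) ,
               Equivalence.to (order 0F 1F) z<s , Equivalence.to (order 1F 2F) (s<s z<s))
      in Peak.impossible a a-starts a-highest

proposition3p4 : ∀ {n} (π : Perm n) → Simple π →
    (Avoids π p1342 × Avoids π p1423) ⇔ Avoids π p123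
proposition3p4 π simple = mk⇔
  (λ (avoids-1342 , avoids-1423) → SimpleAvoider.avoids-123 π simple avoids-1342 avoids-1423)
  (λ avoids-123 → avoids-123 ∘ p1342⇒p123 π , avoids-123 ∘ p1423⇒p123 π)
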